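{- Let $m\ge 4$ and let $n\ge 5$ be odd. Let $G(**)$ be the subgraph of $G_{m,n}=S_m\Box P_n$ induced by $V(S_m)\times\{i: 2\le i\le n-1,\ i\ne \tfrac{n+1}{2}\}$ (equivalently, $G_{m,n}$ minus the star copies at positions $1,\frac{n+1}{2},n$). Then the radio number of $G(**)$ in $G_{m,n}$ satisfies $$rn(G(**))\ge \tfrac{1}{2}\left(mn^2-2mn-3m+2n-12\right).$$
   Context: $S_m$ is the star on $m$ vertices with center $c$ and leaves; $P_n$ is the path with vertices $1,\dots,n$. $G_{m,n}=S_m\Box P_n$ has vertex set $V(S_m)\times\{1,\dots,n\}$, with $(a,i)\sim(b,j)$ iff ($a=b$ and $|i-j|=1$) or ($i=j$ and $ab\in E(S_m)$). Its distance is $d((a,i),(b,j))=d_{S_m}(a,b)+|i-j|$ and its diameter is $n+1$. For a subset $H$ of vertices (or induced subgraph) of $G_{m,n}$, a radio labeling of $H$ in $G_{m,n}$ is a function $f:V(H)\to\mathbb{Z}_{\ge 0}$ with $|f(u)-f(v)|\ge \mathrm{diam}(G_{m,n})+1-d_{G_{m,n}}(u,v)$ for all distinct $u,v\in V(H)$ (distances and diameter taken in $G_{m,n}$); its span is $\max f-\min f$, and $rn(H)$ is the minimum span over all such labelings. -}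

module Defs where

open import Data.Nat using (ℕ; zero; suc; _+_; _*_; _∸_; _≤_; ∣_-_∣)
open import Data.Fin using (Fin; toℕ)
open import Data.Fin.Properties using (_≟_)
open import Data.Product using (_×_; _,_; Σ; ∃-syntax)
open import Relation.Nullary using (¬_; yes; no)
open import Relation.Binary.PropositionalEquality using (_≡_)

-- Star S_m on m vertices: vertices Fin m, center is the vertex zero
-- (requires m ≥ 1), leaves are the other m-1 vertices.
-- Distance in S_m.
dStar : ∀ {m} → Fin m → Fin m → ℕ
dStar a b with a ≟ b
... | yes _ = 0
dStar Fin.zero b | no _ = 1
dStar (Fin.suc a) Fin.zero | no _ = 1
dStar (Fin.suc a) (Fin.suc b) | no _ = 2

-- Path P_n: vertices Fin n, position i ∈ Fin n stands for i+1 ∈ {1,…,n}.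
-- Vertices of G_{m,n} = S_m □ P_n.
Vtx : ℕ → ℕ → Set
Vtx m n = Fin m × Fin n

dist : ∀ {m n} → Vtx m n → Vtx m n → ℕ
dist (a , i) (b , j) = dStar a b + ∣ toℕ i - toℕ j ∣

-- diam(G_{m,n}) = n + 1 (for m ≥ 3)
diam : ℕ → ℕ → ℕ
diam m n = n + 1

-- Positions of G(**): 2 ≤ i ≤ n-1 and i ≠ (n+1)/2, with i = toℕ p + 1.
-- Here 2 * i ≠ n + 1 expresses i ≠ (n+1)/2 (n odd).
InGss : (n : ℕ) → Fin n → Set
InGss n p = (2 ≤ toℕ p + 1) × (toℕ p + 1 ≤ n ∸ 1) × ¬ (2 * (toℕ p + 1) ≡ n + 1)

InH : ∀ m n → Vtx m n → Set
InH m n (a , p) = InGss n p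

-- Radio labeling of H ⊆ V(G_{m,n}) (distances/diameter in G_{m,n}).
-- f is given on all of V(G_{m,n}) but only its values on H matter.
IsRadioLabeling : ∀ m n → (Vtx m n → Set) → (Vtx m n → ℕ) → Set
IsRadioLabeling m n H f =
  ∀ u v → H u → H v → ¬ (u ≡ v) →
    diam m n + 1 ≤ ∣ f u - f v ∣ + dist u v

-- "span(f) ≥ B" on H: max f - min f ≥ B, i.e. some pair u,v in H has f u - f v ≥ B.
-- rn(H) ≥ B  iff  every radio labeling of H has span ≥ B.
-- Here B is given through 2B + c ≥ d form to avoid halves/negatives (see Statement).

{-# OPTIONS --safe #-}
-- Let n = 2k + 1 and let L(x) be the distance from x to the central vertex (c, k).  Since
-- d(u, v) ≤ L(u) + L(v), listing the vertices x₀, …, x_{N-1} of G(**) by increasing label gives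
-- f(x_{i+1}) − f(x_i) ≥ n + 2 − L(x_i) − L(x_{i+1}); summing, the span is at least
-- (N − 1)(n + 2) − 2 Σ L + L(x₀) + L(x_{N-1}), and both endpoint levels are ≥ 1 because the middle
-- copy of the star is removed.  With N = 2m(k − 1) and Σ L = 2(m − 1)(k − 1) + m k(k − 1) this is
-- exactly the stated bound.
module Submission where

open import Defs
open import Data.Nat using (ℕ; zero; suc; _+_; _*_; _∸_; _≤_; _<_; _≤?_; _≟_; z≤n; s≤s; ∣_-_∣)
open import Data.Nat.Properties
open import Data.Nat.ListAction using (sum)
open import Data.Nat.ListAction.Properties using (sum-++; sum-↭)
open import Data.Nat.Tactic.RingSolver using (solve-∀)
open import Data.Fin using (Fin; toℕ)
open import Data.Fin.Properties using () renaming (_≟_ to _≟ᶠ_)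
open import Data.Product using (_×_; _,_; proj₁; proj₂; ∃-syntax)
open import Data.List using (List; []; _∷_; _++_; length; map; filter; applyUpTo; upTo; tabulate; allFin; cartesianProduct)
open import Data.List.Properties
  using (map-++; map-∘; length-++; length-map; length-applyUpTo; length-tabulate; map-tabulate; map-applyUpTo;
         applyUpTo-∷ʳ; ++-identityʳ; filter-++; filter-all; filter-reject)
open import Data.List.Relation.Unary.All using (All; []; _∷_; lookup; head)
open import Data.List.Relation.Unary.All.Properties using (applyUpTo⁺₁; all-filter; cartesianProduct⁺)
open import Data.List.Relation.Unary.Linked using (Linked; []; [-]; _∷_)
open import Data.List.Relation.Unary.AllPairs using (_∷_)
open import Data.List.Relation.Unary.Unique.Propositional using (Unique)
import Data.List.Relation.Unary.Unique.Propositional.Properties as Unique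
open import Data.List.Relation.Binary.Permutation.Propositional using (_↭_; ↭-sym; ↭⇒↭ₛ)
open import Data.List.Relation.Binary.Permutation.Propositional.Properties using (All-resp-↭; ↭-length; map⁺)
import Data.List.Relation.Binary.Permutation.Setoid.Properties as Permutationₛ
import Data.List.Sort as Sort
import Relation.Binary.Construct.On as On
open import Relation.Nullary using (¬_; yes; no; contradiction)
open import Relation.Nullary.Decidable using (_×-dec_; ¬?)
open import Relation.Unary using (Decidable)
open import Relation.Binary.PropositionalEquality
open import Relation.Binary.PropositionalEquality.Properties using (setoid)

module Telescope {V : Set} (f L : V → ℕ) (c : ℕ) where

  Step : V → V → Set
  Step u v = c + f u ≤ f v + (L u + L v)

  lastOf : V → List V → V
  lastOf x []       = x
  lastOf x (y ∷ ys) = lastOf y ys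

  All-lastOf : ∀ {P : V → Set} x xs → All P (x ∷ xs) → P (lastOf x xs)
  All-lastOf x []       (px ∷ _)   = px
  All-lastOf x (y ∷ ys) (_ ∷ pys) = All-lastOf y ys pys

  telescope : ∀ x xs → Linked Step (x ∷ xs) →
    c * length xs + (L x + L (lastOf x xs)) + f x ≤ f (lastOf x xs) + 2 * sum (map L (x ∷ xs))
  telescope x []       _              = ≤-reflexive (base c (L x) (f x))
    where
    base : ∀ c l y → c * 0 + (l + l) + y ≡ y + 2 * (l + 0)
    base = solve-∀
  telescope x (y ∷ ys) (step ∷ steps) =
    add-step (length ys) (L x) (L y) (L (lastOf y ys)) (f x) (f y) (f (lastOf y ys)) (sum (map L (y ∷ ys)))
      (telescope y ys steps) step
    where
    add-step : ∀ r lx ly lz fx fy fz s →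
      c * r + (ly + lz) + fy ≤ fz + 2 * s → c + fx ≤ fy + (lx + ly) →
      c * suc r + (lx + lz) + fx ≤ fz + 2 * (lx + s)
    add-step r lx ly lz fx fy fz s rest first =
      +-cancelʳ-≤ (fy + ly) _ _
        (subst₂ _≤_ (lhs c r lx ly lz fx fy) (rhs lx ly fy fz s)
          (+-monoˡ-≤ lx (+-mono-≤ rest first)))
      where
      lhs : ∀ c r lx ly lz fx fy →
        c * r + (ly + lz) + fy + (c + fx) + lx ≡ c * suc r + (lx + lz) + fx + (fy + ly)
      lhs = solve-∀
      rhs : ∀ lx ly fy fz s → fz + 2 * s + (fy + (lx + ly)) + lx ≡ fz + 2 * (lx + s) + (fy + ly)
      rhs = solve-∀

  open Sort (On.decTotalOrder ≤-decTotalOrder f) using (sort; sort-↭; sort-↗)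

  module _ (Adm : V → Set) (gap : ∀ {u v} → Adm u → Adm v → ¬ u ≡ v → f u ≤ f v → Step u v) where

    steps-of-sorted : ∀ {xs} → Linked (λ u v → f u ≤ f v) xs → Unique xs → All Adm xs → Linked Step xs
    steps-of-sorted []             _                    _                       = []
    steps-of-sorted [-]            _                    _                       = [-]
    steps-of-sorted (u≤v ∷ sorted) ((u≢v ∷ _) ∷ distinct) (adm-u ∷ adms@(adm-v ∷ _)) =
      gap adm-u adm-v u≢v u≤v ∷ steps-of-sorted sorted distinct adms

    endpoint-bound : ∀ xs r → length xs ≡ suc r → Unique xs → All Adm xs →
      ∃[ u ] ∃[ v ] (Adm u × Adm v × c * r + (L v + L u) + f v ≤ f u + 2 * sum (map L xs))
    endpoint-bound xs r len distinct adms = from-sorted (sort xs) (sort-↭ xs) (sort-↗ xs)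
      where
      from-sorted : ∀ zs → zs ↭ xs → Linked (λ u v → f u ≤ f v) zs →
        ∃[ u ] ∃[ v ] (Adm u × Adm v × c * r + (L v + L u) + f v ≤ f u + 2 * sum (map L xs))
      from-sorted []       p _      = contradiction (trans (↭-length p) len) λ ()
      from-sorted (z ∷ zs) p sorted =
        lastOf z zs , z , All-lastOf z zs adms′ , head adms′ ,
        subst₂ (λ l s → c * l + (L z + L (lastOf z zs)) + f z ≤ f (lastOf z zs) + 2 * s)
          (suc-injective (trans (↭-length p) len)) (sum-↭ (map⁺ L p))
          (telescope z zs (steps-of-sorted sorted distinct′ adms′))
        where
        adms′ : All Adm (z ∷ zs)
        adms′ = All-resp-↭ (↭-sym p) adms
        distinct′ : Unique (z ∷ zs)
        distinct′ = Permutationₛ.Unique-resp-↭ (setoid V) (↭⇒↭ₛ (↭-sym p)) distinct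

dStar≤2 : ∀ {m} (a b : Fin m) → dStar a b ≤ 2
dStar≤2 a b with a ≟ᶠ b
... | yes _ = z≤n
dStar≤2 Fin.zero    b           | no _ = s≤s z≤n
dStar≤2 (Fin.suc a) Fin.zero    | no _ = s≤s z≤n
dStar≤2 (Fin.suc a) (Fin.suc b) | no _ = ≤-refl

dStar-via-centre : ∀ {m} (a b : Fin (suc m)) → dStar a b ≤ dStar a Fin.zero + dStar b Fin.zero
dStar-via-centre Fin.zero    Fin.zero    = z≤n
dStar-via-centre Fin.zero    (Fin.suc b) = ≤-refl
dStar-via-centre (Fin.suc a) Fin.zero    = m≤m+n _ _
dStar-via-centre (Fin.suc a) (Fin.suc b) = dStar≤2 (Fin.suc a) (Fin.suc b)

level : ∀ {m n} → ℕ → Vtx (suc m) n → ℕ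
level k (a , p) = dStar a Fin.zero + ∣ toℕ p - k ∣

dist≤level+level : ∀ {m n} k (u v : Vtx (suc m) n) → dist u v ≤ level k u + level k v
dist≤level+level k (a , i) (b , j) = begin
  dStar a b + ∣ toℕ i - toℕ j ∣
    ≤⟨ +-mono-≤ (dStar-via-centre a b) (∣-∣-triangle (toℕ i) k (toℕ j)) ⟩
  (dStar a Fin.zero + dStar b Fin.zero) + (∣ toℕ i - k ∣ + ∣ k - toℕ j ∣)
    ≡⟨ cong (λ t → (dStar a Fin.zero + dStar b Fin.zero) + (∣ toℕ i - k ∣ + t)) (∣-∣-comm k (toℕ j)) ⟩
  (dStar a Fin.zero + dStar b Fin.zero) + (∣ toℕ i - k ∣ + ∣ toℕ j - k ∣)
    ≡⟨ +-comm-middle (dStar a Fin.zero) (dStar b Fin.zero) (∣ toℕ i - k ∣) (∣ toℕ j - k ∣) ⟩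
  (dStar a Fin.zero + ∣ toℕ i - k ∣) + (dStar b Fin.zero + ∣ toℕ j - k ∣) ∎
  where
  open ≤-Reasoning
  +-comm-middle : ∀ a b c d → (a + b) + (c + d) ≡ (a + c) + (b + d)
  +-comm-middle = solve-∀

radio-step : ∀ {m n H f} → IsRadioLabeling (suc m) n H f → ∀ k {u v} → H u → H v → ¬ u ≡ v → f u ≤ f v →
  diam (suc m) n + 1 + f u ≤ f v + (level k u + level k v)
radio-step {m} {n} {f = f} radio k {u} {v} Hu Hv u≢v fu≤fv = begin
  diam (suc m) n + 1 + f u
    ≤⟨ +-monoˡ-≤ (f u) (radio u v Hu Hv u≢v) ⟩
  ∣ f u - f v ∣ + dist u v + f u
    ≡⟨ cong (λ t → t + dist u v + f u) (m≤n⇒∣m-n∣≡n∸m fu≤fv) ⟩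
  f v ∸ f u + dist u v + f u
    ≤⟨ +-monoˡ-≤ (f u) (+-monoʳ-≤ (f v ∸ f u) (dist≤level+level k u v)) ⟩
  f v ∸ f u + Λ + f u
    ≡⟨ +-comm-last (f v ∸ f u) Λ (f u) ⟩
  f v ∸ f u + f u + Λ
    ≡⟨ cong (_+ Λ) (m∸n+n≡m fu≤fv) ⟩
  f v + Λ ∎
  where
  open ≤-Reasoning
  Λ = level k u + level k v
  +-comm-last : ∀ a b c → a + b + c ≡ a + c + b
  +-comm-last = solve-∀

2*[k+1]≡2*k+1+1 : ∀ k → 2 * (k + 1) ≡ 2 * k + 1 + 1
2*[k+1]≡2*k+1+1 = solve-∀

level-positive : ∀ {m} k (a : Fin (suc m)) (p : Fin (2 * k + 1)) → InGss (2 * k + 1) p → 1 ≤ level k (a , p)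
level-positive k a p (_ , _ , not-centre) =
  ≤-trans (n≢0⇒n>0 λ p-at-centre →
             not-centre (trans (cong (λ i → 2 * (i + 1)) (∣m-n∣≡0⇒m≡n {toℕ p} {k} p-at-centre))
                               (2*[k+1]≡2*k+1+1 k)))
          (m≤n+m _ (dStar a Fin.zero))

applyUpTo-++ : ∀ {A : Set} (f : ℕ → A) a b → applyUpTo f (a + b) ≡ applyUpTo f a ++ applyUpTo (λ i → f (a + i)) b
applyUpTo-++ f zero    b = refl
applyUpTo-++ f (suc a) b = cong (f 0 ∷_) (applyUpTo-++ (λ i → f (suc i)) a b)

applyUpTo-cong : ∀ {A : Set} {f g : ℕ → A} → (∀ i → f i ≡ g i) → ∀ n → applyUpTo f n ≡ applyUpTo g n
applyUpTo-cong f≗g zero    = refl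
applyUpTo-cong f≗g (suc n) = cong₂ _∷_ (f≗g 0) (applyUpTo-cong (λ i → f≗g (suc i)) n)

tabulate-toℕ : ∀ {A : Set} n (f : ℕ → A) → tabulate (λ (i : Fin n) → f (toℕ i)) ≡ applyUpTo f n
tabulate-toℕ zero    f = refl
tabulate-toℕ (suc n) f = cong (f 0 ∷_) (tabulate-toℕ n (λ i → f (suc i)))

map-toℕ-allFin : ∀ n → map toℕ (allFin n) ≡ upTo n
map-toℕ-allFin n = trans (map-tabulate (λ i → i) toℕ) (tabulate-toℕ n (λ i → i))

map-filter-∘ : ∀ {A B : Set} {P : B → Set} (P? : Decidable P) (g : A → B) xs →
  map g (filter (λ x → P? (g x)) xs) ≡ filter P? (map g xs)
map-filter-∘ P? g []       = refl
map-filter-∘ P? g (x ∷ xs) with P? (g x)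
... | yes _ = cong (g x ∷_) (map-filter-∘ P? g xs)
... | no  _ = map-filter-∘ P? g xs

length-cartesianProduct : ∀ {A B : Set} (xs : List A) (ys : List B) →
  length (cartesianProduct xs ys) ≡ length xs * length ys
length-cartesianProduct []       ys = refl
length-cartesianProduct (x ∷ xs) ys =
  trans (length-++ (map (x ,_) ys)) (cong₂ _+_ (length-map (x ,_) ys) (length-cartesianProduct xs ys))

sum-map-const+ : ∀ {A : Set} c (h : A → ℕ) xs → sum (map (λ x → c + h x) xs) ≡ length xs * c + sum (map h xs)
sum-map-const+ c h []       = refl
sum-map-const+ c h (x ∷ xs) = trans (cong (c + h x +_) (sum-map-const+ c h xs)) (shuffle c (h x) (length xs * c) _)
  where
  shuffle : ∀ c y lc s → c + y + (lc + s) ≡ c + lc + (y + s)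
  shuffle = solve-∀

sum-map-cartesianProduct : ∀ {A B : Set} (g : A → ℕ) (h : B → ℕ) xs ys →
  sum (map (λ z → g (proj₁ z) + h (proj₂ z)) (cartesianProduct xs ys)) ≡
  length ys * sum (map g xs) + length xs * sum (map h ys)
sum-map-cartesianProduct g h []       ys = sym (cong (_+ 0) (*-zeroʳ (length ys)))
sum-map-cartesianProduct g h (x ∷ xs) ys = begin
  sum (map G (map (x ,_) ys ++ cartesianProduct xs ys))
    ≡⟨ cong sum (map-++ G (map (x ,_) ys) _) ⟩
  sum (map G (map (x ,_) ys) ++ map G (cartesianProduct xs ys))
    ≡⟨ sum-++ (map G (map (x ,_) ys)) _ ⟩
  sum (map G (map (x ,_) ys)) + sum (map G (cartesianProduct xs ys))
    ≡⟨ cong₂ _+_ (trans (cong sum (sym (map-∘ ys))) (sum-map-const+ (g x) h ys))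
                 (sum-map-cartesianProduct g h xs ys) ⟩
  (length ys * g x + sum (map h ys)) + (length ys * sum (map g xs) + length xs * sum (map h ys))
    ≡⟨ regroup (length ys) (g x) (sum (map h ys)) (sum (map g xs)) (length xs) ⟩
  length ys * (g x + sum (map g xs)) + suc (length xs) * sum (map h ys) ∎
  where
  open ≡-Reasoning
  G = λ z → g (proj₁ z) + h (proj₂ z)
  regroup : ∀ ly gx sh sg lx → (ly * gx + sh) + (ly * sg + lx * sh) ≡ ly * (gx + sg) + suc lx * sh
  regroup = solve-∀

sum-dStar-centre : ∀ m → sum (map (λ a → dStar a Fin.zero) (allFin (suc m))) ≡ m
sum-dStar-centre m = trans (cong sum (map-tabulate {n = suc m} (λ i → i) (λ a → dStar a Fin.zero))) (sum-ones m)
  where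
  sum-ones : ∀ m → sum (tabulate (λ (_ : Fin m) → 1)) ≡ m
  sum-ones zero    = refl
  sum-ones (suc m) = cong suc (sum-ones m)

gauss-pair : ∀ D → sum (applyUpTo (λ t → ∣ t - D ∣) D) + sum (applyUpTo suc D) ≡ D * suc D
gauss-pair zero    = refl
gauss-pair (suc D) = begin
  (suc D + sum down) + sum (applyUpTo suc (suc D))
    ≡⟨ cong (λ xs → (suc D + sum down) + sum xs) (sym (applyUpTo-∷ʳ suc D)) ⟩
  (suc D + sum down) + sum (up ++ suc D ∷ [])
    ≡⟨ cong ((suc D + sum down) +_) (sum-++ up (suc D ∷ [])) ⟩
  (suc D + sum down) + (sum up + (suc D + 0))
    ≡⟨ regroup (suc D) (sum down) (sum up) ⟩
  2 * suc D + (sum down + sum up)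
    ≡⟨ cong (2 * suc D +_) (gauss-pair D) ⟩
  2 * suc D + D * suc D
    ≡⟨ close D ⟩
  suc D * suc (suc D) ∎
  where
  open ≡-Reasoning
  down = applyUpTo (λ t → ∣ t - D ∣) D
  up   = applyUpTo suc D
  regroup : ∀ k x y → (k + x) + (y + (k + 0)) ≡ 2 * k + (x + y)
  regroup = solve-∀
  close : ∀ D → 2 * suc D + D * suc D ≡ suc D * suc (suc D)
  close = solve-∀

InGssℕ : ℕ → ℕ → Set
InGssℕ n i = (2 ≤ i + 1) × (i + 1 ≤ n ∸ 1) × ¬ (2 * (i + 1) ≡ n + 1)

inGssℕ? : ∀ n → Decidable (InGssℕ n)
inGssℕ? n i = (2 ≤? i + 1) ×-dec ((i + 1 ≤? n ∸ 1) ×-dec ¬? (2 * (i + 1) ≟ n + 1))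

inGssℕ-intro : ∀ {k i} → 1 ≤ i → i < 2 * k → ¬ i ≡ k → InGssℕ (2 * k + 1) i
inGssℕ-intro {k} {i} 1≤i i<2k i≢k =
  +-monoˡ-≤ 1 1≤i ,
  subst₂ _≤_ (+-comm 1 i) (sym (m+n∸n≡m (2 * k) 1)) i<2k ,
  λ eq → i≢k (+-cancelʳ-≡ 1 i k (*-cancelˡ-≡ (i + 1) (k + 1) 2 (trans eq (sym (2*[k+1]≡2*k+1+1 k)))))

¬InGssℕ-first : ∀ n → ¬ InGssℕ n 0
¬InGssℕ-first n (s≤s () , _)

¬InGssℕ-centre : ∀ k → ¬ InGssℕ (2 * k + 1) k
¬InGssℕ-centre k (_ , _ , not-centre) = not-centre (2*[k+1]≡2*k+1+1 k)

¬InGssℕ-last : ∀ k → ¬ InGssℕ (2 * k + 1) (2 * k)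
¬InGssℕ-last k (_ , below-last , _) =
  <-irrefl refl (subst₂ _≤_ (+-comm (2 * k) 1) (m+n∸n≡m (2 * k) 1) below-last)

upTo-around-centre : ∀ D → upTo (2 * suc D + 1) ≡
  (0 ∷ applyUpTo suc D) ++ ((suc D ∷ applyUpTo (λ t → suc D + suc t) D) ++ 2 * suc D ∷ [])
upTo-around-centre D = begin
  upTo (2 * suc D + 1)
    ≡⟨ cong upTo (split D) ⟩
  upTo (suc D + (suc D + 1))
    ≡⟨ applyUpTo-++ (λ i → i) (suc D) (suc D + 1) ⟩
  upTo (suc D) ++ applyUpTo (suc D +_) (suc D + 1)
    ≡⟨ cong (upTo (suc D) ++_) (applyUpTo-++ (suc D +_) (suc D) 1) ⟩
  upTo (suc D) ++ ((suc D + 0 ∷ applyUpTo (λ t → suc D + suc t) D) ++ 2 * suc D ∷ [])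
    ≡⟨ cong (λ c → upTo (suc D) ++ ((c ∷ applyUpTo (λ t → suc D + suc t) D) ++ 2 * suc D ∷ []))
            (+-identityʳ (suc D)) ⟩
  (0 ∷ applyUpTo suc D) ++ ((suc D ∷ applyUpTo (λ t → suc D + suc t) D) ++ 2 * suc D ∷ []) ∎
  where
  open ≡-Reasoning
  split : ∀ D → 2 * suc D + 1 ≡ suc D + (suc D + 1)
  split = solve-∀

filter-gssℕ : ∀ D → filter (inGssℕ? (2 * suc D + 1)) (upTo (2 * suc D + 1)) ≡
  applyUpTo suc D ++ applyUpTo (λ t → suc D + suc t) D
filter-gssℕ D = begin
  filter P? (upTo n)
    ≡⟨ cong (filter P?) (upTo-around-centre D) ⟩
  filter P? ((0 ∷ left) ++ ((suc D ∷ right) ++ 2 * suc D ∷ []))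
    ≡⟨ filter-++ P? (0 ∷ left) _ ⟩
  filter P? (0 ∷ left) ++ filter P? ((suc D ∷ right) ++ 2 * suc D ∷ [])
    ≡⟨ cong (filter P? (0 ∷ left) ++_) (filter-++ P? (suc D ∷ right) _) ⟩
  filter P? (0 ∷ left) ++ (filter P? (suc D ∷ right) ++ filter P? (2 * suc D ∷ []))
    ≡⟨ cong₂ _++_ (trans (filter-reject P? {x = 0} {xs = left} (¬InGssℕ-first n)) (filter-all P? left-inside))
                  (cong₂ _++_ (trans (filter-reject P? {x = suc D} {xs = right} (¬InGssℕ-centre (suc D))) (filter-all P? right-inside))
                              (filter-reject P? {x = 2 * suc D} {xs = []} (¬InGssℕ-last (suc D)))) ⟩
  left ++ (right ++ [])
    ≡⟨ cong (left ++_) (++-identityʳ right) ⟩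
  left ++ right ∎
  where
  open ≡-Reasoning
  n = 2 * suc D + 1
  P? = inGssℕ? n
  left = applyUpTo suc D
  right = applyUpTo (λ t → suc D + suc t) D
  left-inside : All (InGssℕ n) left
  left-inside = applyUpTo⁺₁ suc D λ t<D →
    inGssℕ-intro (s≤s z≤n) (≤-trans (s≤s t<D) (m≤m+n (suc D) _)) (λ eq → <⇒≢ t<D (suc-injective eq))
  right-inside : All (InGssℕ n) right
  right-inside = applyUpTo⁺₁ (λ t → suc D + suc t) D λ {t} t<D →
    inGssℕ-intro (s≤s z≤n)
      (subst (suc D + suc t <_) (cong (suc D +_) (sym (+-identityʳ (suc D)))) (+-monoʳ-< (suc D) (s≤s t<D)))
      (m+1+n≢m (suc D))

sum-distances-gssℕ : ∀ D →
  sum (map (λ i → ∣ i - suc D ∣) (applyUpTo suc D ++ applyUpTo (λ t → suc D + suc t) D)) ≡ D * suc D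
sum-distances-gssℕ D = begin
  sum (map g (left ++ right))
    ≡⟨ cong sum (map-++ g left right) ⟩
  sum (map g left ++ map g right)
    ≡⟨ sum-++ (map g left) (map g right) ⟩
  sum (map g left) + sum (map g right)
    ≡⟨ cong₂ _+_ (cong sum (map-applyUpTo suc g D))
                 (cong sum (trans (map-applyUpTo _ g D) (applyUpTo-cong right-distance D))) ⟩
  sum (applyUpTo (λ t → ∣ t - D ∣) D) + sum (applyUpTo suc D)
    ≡⟨ gauss-pair D ⟩
  D * suc D ∎
  where
  open ≡-Reasoning
  g = λ i → ∣ i - suc D ∣
  left = applyUpTo suc D
  right = applyUpTo (λ t → suc D + suc t) D
  right-distance : ∀ t → ∣ D + suc t - D ∣ ≡ suc t
  right-distance t = trans (∣-∣-comm (D + suc t) D) (∣m-m+n∣≡n D (suc t))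

gssPositions : ∀ n → List (Fin n)
gssPositions n = filter (λ p → inGssℕ? n (toℕ p)) (allFin n)

gssVertices : ∀ m n → List (Vtx m n)
gssVertices m n = cartesianProduct (allFin m) (gssPositions n)

gssVertices-unique : ∀ m n → Unique (gssVertices m n)
gssVertices-unique m n =
  Unique.cartesianProduct⁺ (Unique.allFin⁺ m) (Unique.filter⁺ (λ p → inGssℕ? n (toℕ p)) (Unique.allFin⁺ n))

gssVertices-inH : ∀ m n → All (InH m n) (gssVertices m n)
gssVertices-inH m n = cartesianProduct⁺ (setoid (Fin m)) (setoid (Fin n)) (allFin m) (gssPositions n)
  (λ _ p∈positions → lookup (all-filter (λ p → inGssℕ? n (toℕ p)) (allFin n)) p∈positions)

module _ (D : ℕ) where

  private
    n = 2 * suc D + 1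

  map-toℕ-gssPositions : map toℕ (gssPositions n) ≡ applyUpTo suc D ++ applyUpTo (λ t → suc D + suc t) D
  map-toℕ-gssPositions =
    trans (map-filter-∘ (inGssℕ? n) toℕ (allFin n))
          (trans (cong (filter (inGssℕ? n)) (map-toℕ-allFin n)) (filter-gssℕ D))

  length-gssPositions : length (gssPositions n) ≡ D + D
  length-gssPositions = begin
    length (gssPositions n)                                           ≡⟨ length-map toℕ (gssPositions n) ⟨
    length (map toℕ (gssPositions n))                                 ≡⟨ cong length map-toℕ-gssPositions ⟩
    length (applyUpTo suc D ++ applyUpTo (λ t → suc D + suc t) D)    ≡⟨ length-++ (applyUpTo suc D) ⟩
    length (applyUpTo suc D) + length (applyUpTo (λ t → suc D + suc t) D)
      ≡⟨ cong₂ _+_ (length-applyUpTo suc D) (length-applyUpTo _ D) ⟩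
    D + D ∎
    where open ≡-Reasoning

  sum-distances-gssPositions : sum (map (λ p → ∣ toℕ p - suc D ∣) (gssPositions n)) ≡ D * suc D
  sum-distances-gssPositions =
    trans (cong sum (map-∘ (gssPositions n)))
          (trans (cong (λ is → sum (map (λ i → ∣ i - suc D ∣) is)) map-toℕ-gssPositions) (sum-distances-gssℕ D))

  length-gssVertices : ∀ m → length (gssVertices m n) ≡ m * (D + D)
  length-gssVertices m =
    trans (length-cartesianProduct (allFin m) (gssPositions n))
          (cong₂ _*_ (length-tabulate {n = m} (λ i → i)) length-gssPositions)

  sum-level-gssVertices : ∀ m →
    sum (map (level (suc D)) (gssVertices (suc m) n)) ≡ (D + D) * m + suc m * (D * suc D)
  sum-level-gssVertices m =
    trans (sum-map-cartesianProduct (λ a → dStar a Fin.zero) (λ p → ∣ toℕ p - suc D ∣)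
                                    (allFin (suc m)) (gssPositions n))
          (cong₂ _+_ (cong₂ _*_ length-gssPositions (sum-dStar-centre m))
                     (cong₂ _*_ (length-tabulate {n = suc m} (λ i → i)) sum-distances-gssPositions))

drop-levels : ∀ c r lu lv fu fv s → 1 ≤ lu → 1 ≤ lv →
  c * r + (lv + lu) + fv ≤ fu + 2 * s → c * r + 2 ≤ (fu ∸ fv) + 2 * s
drop-levels c r lu lv fu fv s 1≤lu 1≤lv bound = +-cancelˡ-≤ fv _ _ (begin
  fv + (c * r + 2)          ≡⟨ +-comm fv (c * r + 2) ⟩
  c * r + (1 + 1) + fv      ≤⟨ +-monoˡ-≤ fv (+-monoʳ-≤ (c * r) (+-mono-≤ 1≤lv 1≤lu)) ⟩
  c * r + (lv + lu) + fv    ≤⟨ bound ⟩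
  fu + 2 * s                ≤⟨ +-monoˡ-≤ (2 * s) (m≤n+m∸n fu fv) ⟩
  fv + (fu ∸ fv) + 2 * s    ≡⟨ +-assoc fv (fu ∸ fv) (2 * s) ⟩
  fv + ((fu ∸ fv) + 2 * s)  ∎)
  where open ≤-Reasoning

span-identity : ∀ m0 j →
  2 * ((2 * suc (suc j) + 1 + 1 + 1) * (j + suc j + m0 * (suc j + suc j)) + 2)
    + (2 * (suc m0 * (2 * suc (suc j) + 1)) + 3 * suc m0 + 12)
  ≡ suc m0 * ((2 * suc (suc j) + 1) * (2 * suc (suc j) + 1)) + 2 * (2 * suc (suc j) + 1)
    + 4 * ((suc j + suc j) * m0 + suc m0 * (suc j * suc (suc j)))
span-identity = solve-∀

module _ (m0 j : ℕ) where

  -- G(**) has r + 1 = 2m(k − 1) vertices, whose levels sum to S.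
  private
    m = suc m0
    D = suc j
    k = suc D
    n = 2 * k + 1
    r = j + suc j + m0 * (suc j + suc j)
    S = (D + D) * m0 + m * (D * suc D)

  gss-span-bound : (f : Vtx m n → ℕ) → IsRadioLabeling m n (InH m n) f →
    ∃[ u ] ∃[ v ] (InH m n u × InH m n v × (diam m n + 1) * r + 2 ≤ (f u ∸ f v) + 2 * S)
  gss-span-bound f radio =
    let u , v , Hu , Hv , bound =
          Telescope.endpoint-bound f (level k) (diam m n + 1) (InH m n) (radio-step radio k)
            (gssVertices m n) r (length-gssVertices D m) (gssVertices-unique m n) (gssVertices-inH m n)
    in u , v , Hu , Hv ,
       drop-levels (diam m n + 1) r (level k u) (level k v) (f u) (f v) S
         (level-positive k (proj₁ u) (proj₂ u) Hu) (level-positive k (proj₁ v) (proj₂ v) Hv)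
         (subst (λ s → (diam m n + 1) * r + (level k v + level k u) + f v ≤ f u + 2 * s)
                (sum-level-gssVertices D m0) bound)

  span-arith : ∀ Δ → (diam m n + 1) * r + 2 ≤ Δ + 2 * S →
    m * (n * n) + 2 * n ≤ 2 * Δ + (2 * (m * n) + 3 * m + 12)
  span-arith Δ h =
    +-cancelʳ-≤ (4 * S) _ _
      (subst₂ _≤_ (span-identity m0 j) (regroup Δ S (2 * (m * n) + 3 * m + 12))
        (+-monoˡ-≤ (2 * (m * n) + 3 * m + 12) (*-monoʳ-≤ 2 h)))
    where
    regroup : ∀ Δ S C → 2 * (Δ + 2 * S) + C ≡ 2 * Δ + C + 4 * S
    regroup = solve-∀

  gss-lower-bound : (f : Vtx m n → ℕ) → IsRadioLabeling m n (InH m n) f →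
    ∃[ u ] ∃[ v ] (InH m n u × InH m n v × m * (n * n) + 2 * n ≤ 2 * (f u ∸ f v) + (2 * (m * n) + 3 * m + 12))
  gss-lower-bound f radio =
    let u , v , Hu , Hv , bound = gss-span-bound f radio in u , v , Hu , Hv , span-arith (f u ∸ f v) bound

lemma4 : (m n : ℕ) → 4 ≤ m → 5 ≤ n → (∃[ k ] n ≡ 2 * k + 1) →
    (f : Vtx m n → ℕ) → IsRadioLabeling m n (InH m n) f →
    ∃[ u ] ∃[ v ] (InH m n u × InH m n v ×
      m * (n * n) + 2 * n ≤ 2 * (f u ∸ f v) + (2 * (m * n) + 3 * m + 12))
lemma4 zero     _ () _   _                    _ _
lemma4 (suc m0) _ _ 5≤n (zero , refl)        _ _ = contradiction 5≤n λ { (s≤s ()) }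
lemma4 (suc m0) _ _ 5≤n (suc zero , refl)    _ _ = contradiction 5≤n λ { (s≤s (s≤s (s≤s ()))) }
lemma4 (suc m0) _ _ _   (suc (suc j) , refl) f radio = gss-lower-bound m0 j f radio
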